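{- Let $G$ be a graph on vertex set $[n]$, let $D\le n$ be a positive integer, let $1\le i<n$, and let $\sigma,\tau$ be orderings of $[n]$ such that $\sigma_j=\tau_j$ for all $j\in[n]\setminus\{i,i+1\}$, $\sigma_{i+1}=\tau_i$ and $\sigma_i=\tau_{i+1}$. If $\{\sigma_i,\sigma_{i+1}\}$ is an edge of $G$, then $GOR^+_\sigma=GOR^+_\tau$ (for representations in $\mathbb R^D$).
   Context: A representation of $G$ in $\mathbb R^D$ is a tuple $(v_1,\dots,v_n)$ of vectors in $\mathbb R^D$, viewed as a point of $\mathbb R^{nD}$. An ordering $\sigma=\sigma_1\sigma_2\cdots\sigma_n$ of $[n]$ is a listing of all vertices. $GOR^+_\sigma$ is the set of all representations that can be produced by the following process: for $i=1,\dots,n$ in turn, let $u_1,\dots,u_k$ be the vectors already assigned to the vertices $\sigma_j$ with $j<i$ that are not adjacent to $\sigma_i$; if $u_1,\dots,u_k$ are linearly independent (including $k=0$), choose $v_{\sigma_i}$ to be any vector of $\mathbb R^D$ orthogonal to all of $u_1,\dots,u_k$; otherwise set $v_{\sigma_i}=0$. -}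

module Defs where

open import Level using (0ℓ)
open import Data.Nat using (ℕ; zero; suc)
open import Data.Fin using (Fin; zero; suc; toℕ; _<_)
open import Data.Fin.Permutation using (Permutation′; _⟨$⟩ʳ_)
open import Data.Product using (Σ; ∃; _×_; _,_)
open import Data.Sum using (_⊎_)
open import Relation.Nullary using (¬_)
open import Relation.Binary.PropositionalEquality using (_≡_)
import Algebra.Structures as AS

-- The real numbers, given axiomatically as a complete ordered field
-- (unique up to isomorphism).  Equality on the carrier is _≡_.

record RealField : Set₁ where
  infixl 6 _+_
  infixl 7 _*_
  infix 4 _<ᵣ_ _≤ᵣ_
  field
    ℝ     : Set
    _+_   : ℝ → ℝ → ℝ
    _*_   : ℝ → ℝ → ℝ
    -_    : ℝ → ℝ
    0ᵣ    : ℝ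
    1ᵣ    : ℝ
    isCommutativeRing : AS.IsCommutativeRing {A = ℝ} _≡_ _+_ _*_ -_ 0ᵣ 1ᵣ
    0≢1   : ¬ (0ᵣ ≡ 1ᵣ)
    inv   : (x : ℝ) → ¬ (x ≡ 0ᵣ) → ℝ
    inv-r : (x : ℝ) (p : ¬ (x ≡ 0ᵣ)) → x * inv x p ≡ 1ᵣ
    _<ᵣ_  : ℝ → ℝ → Set
    <-irrefl : ∀ x → ¬ (x <ᵣ x)
    <-trans  : ∀ {x y z} → x <ᵣ y → y <ᵣ z → x <ᵣ z
    <-trichotomy : ∀ x y → x <ᵣ y ⊎ (x ≡ y ⊎ y <ᵣ x)
    +-mono-< : ∀ {x y} z → x <ᵣ y → x + z <ᵣ y + z
    *-pos    : ∀ {x y} → 0ᵣ <ᵣ x → 0ᵣ <ᵣ y → 0ᵣ <ᵣ x * y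
  _≤ᵣ_ : ℝ → ℝ → Set
  x ≤ᵣ y = x <ᵣ y ⊎ x ≡ y
  field
    complete : (P : ℝ → Set) → ∃ P → ∃ (λ b → ∀ x → P x → x ≤ᵣ b) →
               ∃ (λ s → (∀ x → P x → x ≤ᵣ s) ×
                        (∀ b → (∀ x → P x → x ≤ᵣ b) → s ≤ᵣ b))

module Orth (R : RealField) where
  open RealField R

  Vec : ℕ → Set
  Vec D = Fin D → ℝ

  sumᶠ : ∀ {m} → (Fin m → ℝ) → ℝ
  sumᶠ {zero}  f = 0ᵣ
  sumᶠ {suc m} f = f zero + sumᶠ (λ k → f (suc k))

  _·_ : ∀ {D} → Vec D → Vec D → ℝ
  u · w = sumᶠ (λ d → u d * w d)

  IsZeroVec : ∀ {D} → Vec D → Set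
  IsZeroVec u = ∀ d → u d ≡ 0ᵣ

  record Graph (n : ℕ) : Set₁ where
    field
      Adj     : Fin n → Fin n → Set
      sym     : ∀ {a b} → Adj a b → Adj b a
      irrefl  : ∀ a → ¬ Adj a a

  Rep : ℕ → ℕ → Set
  Rep n D = Fin n → Vec D

  module _ {n D : ℕ} (G : Graph n) (σ : Permutation′ n) (v : Rep n D) where
    open Graph G

    Earlier : Fin n → Fin n → Set
    Earlier i j = (j < i) × ¬ Adj (σ ⟨$⟩ʳ j) (σ ⟨$⟩ʳ i)

    PrevIndep : Fin n → Set
    PrevIndep i =
      (c : Fin n → ℝ) → (∀ j → ¬ Earlier i j → c j ≡ 0ᵣ) →
      (∀ d → sumᶠ (λ j → c j * v (σ ⟨$⟩ʳ j) d) ≡ 0ᵣ) →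
      ∀ j → c j ≡ 0ᵣ

    StepOK : Fin n → Set
    StepOK i =
      (PrevIndep i × (∀ j → Earlier i j → v (σ ⟨$⟩ʳ i) · v (σ ⟨$⟩ʳ j) ≡ 0ᵣ))
      ⊎ (¬ PrevIndep i × IsZeroVec (v (σ ⟨$⟩ʳ i)))

  GOR⁺ : ∀ {n D} → Graph n → Permutation′ n → Rep n D → Set
  GOR⁺ G σ v = ∀ i → StepOK G σ v i

-- Swapping two adjacent positions i, i+1 of an ordering changes, for each vertex,
-- neither the set of earlier non-adjacent vertices nor (up to reindexing) the
-- linear dependencies among their vectors: the only pair of positions whose
-- relative order is reversed holds the vertices of an edge, which never
-- constrain each other.  So every step of the construction imposes the same
-- condition for σ and for τ.
module Submission where

open import Defs
open import Level using (0ℓ)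
open import Data.Nat as ℕ using (ℕ; suc; _≤_)
import Data.Nat.Properties as ℕₚ
open import Data.Fin as Fin using (Fin; toℕ; _<_; _≟_)
open import Data.Fin.Properties using (toℕ-injective; <-cmp; <-asym; <-irrefl)
open import Data.Fin.Permutation as Perm
  using (Permutation′; _⟨$⟩ʳ_; _⟨$⟩ˡ_; flip; inverseˡ; inverseʳ)
import Data.Fin.Permutation.Components as PC
open import Data.Product using (_×_; _,_)
open import Data.Sum using (inj₁; inj₂)
open import Data.Empty using (⊥-elim)
open import Function.Base using (_∘_)
open import Function.Bundles using (_⇔_; mk⇔; Equivalence)
import Function.Properties.Equivalence as ⇔
open import Relation.Binary.Definitions using (tri<; tri≈; tri>)
open import Relation.Nullary using (¬_; yes; no)
open import Relation.Binary.PropositionalEquality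
  using (_≡_; _≢_; refl; sym; trans; cong; cong₂; subst; subst₂; module ≡-Reasoning)
open import Algebra.Bundles using (CommutativeMonoid)
import Algebra.Structures as AS
import Algebra.Properties.CommutativeMonoid.Sum as CommutativeMonoidSum

module _ {n : ℕ} where

  data TransposeView (i j k : Fin n) : Fin n → Set where
    at-i  : k ≡ i → TransposeView i j k j
    at-j  : k ≡ j → TransposeView i j k i
    other : k ≢ i → k ≢ j → TransposeView i j k k

  transpose-view : ∀ i j k → TransposeView i j k (PC.transpose i j k)
  transpose-view i j k with k ≟ i
  ... | yes k≡i = at-i k≡i
  ... | no k≢i with k ≟ j
  ...   | yes k≡j = at-j k≡j
  ...   | no k≢j = other k≢i k≢j

  ∘transpose≗ : ∀ {A : Set} {i j : Fin n} (f g : Fin n → A) →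
    (∀ k → k ≢ i → k ≢ j → f k ≡ g k) → f j ≡ g i → f i ≡ g j →
    ∀ k → f (PC.transpose i j k) ≡ g k
  ∘transpose≗ {i = i} {j} f g f≡g fj≡gi fi≡gj k
    with PC.transpose i j k | transpose-view i j k
  ... | _ | at-i refl = fj≡gi
  ... | _ | at-j refl = fi≡gj
  ... | _ | other k≢i k≢j = f≡g k k≢i k≢j

module AdjacentTransposition {n : ℕ} {i i' : Fin n} (1+i≡i' : suc (toℕ i) ≡ toℕ i') where

  i<i' : i < i'
  i<i' = ℕₚ.≤-reflexive 1+i≡i'

  <i'⇒≤i : ∀ {ℓ : Fin n} → ℓ < i' → toℕ ℓ ≤ toℕ i
  <i'⇒≤i {ℓ} ℓ<i' = ℕₚ.≤-pred (subst (toℕ ℓ ℕ.<_) (sym 1+i≡i') ℓ<i')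

  >i⇒≥i' : ∀ {ℓ : Fin n} → i < ℓ → toℕ i' ≤ toℕ ℓ
  >i⇒≥i' {ℓ} = subst (_≤ toℕ ℓ) 1+i≡i'

  transpose-< : ∀ {j k} → j < k → ¬ (j ≡ i × k ≡ i') →
    PC.transpose i i' j < PC.transpose i i' k
  transpose-< {j} {k} j<k ¬ii'
    with PC.transpose i i' j | transpose-view i i' j
       | PC.transpose i i' k | transpose-view i i' k
  ... | _ | at-i refl   | _ | at-i refl    = ⊥-elim (<-irrefl refl j<k)
  ... | _ | at-i refl   | _ | at-j refl    = ⊥-elim (¬ii' (refl , refl))
  ... | _ | at-i refl   | _ | other _ k≢i' =
        ℕₚ.≤∧≢⇒< (>i⇒≥i' j<k) (λ i'≡k → k≢i' (sym (toℕ-injective i'≡k)))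
  ... | _ | at-j refl   | _ | at-i refl    = ⊥-elim (<-asym j<k i<i')
  ... | _ | at-j refl   | _ | at-j refl    = ⊥-elim (<-irrefl refl j<k)
  ... | _ | at-j refl   | _ | other _ _    = ℕₚ.<-trans i<i' j<k
  ... | _ | other _ _   | _ | at-i refl    = ℕₚ.<-trans j<k i<i'
  ... | _ | other j≢i _ | _ | at-j refl    =
        ℕₚ.≤∧≢⇒< (<i'⇒≤i j<k) (j≢i ∘ toℕ-injective)
  ... | _ | other _ _   | _ | other _ _    = j<k

  transpose-<⁻¹ : ∀ {j k} → PC.transpose i i' j < PC.transpose i i' k →
    ¬ (k ≡ i × j ≡ i') → j < k
  transpose-<⁻¹ {j} {k} ρj<ρk ¬ii' with <-cmp j k
  ... | tri< j<k _ _ = j<k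
  ... | tri≈ _ refl _ = ⊥-elim (<-irrefl refl ρj<ρk)
  ... | tri> _ _ k<j = ⊥-elim (<-asym ρj<ρk (transpose-< k<j ¬ii'))

module _ (R : RealField) where
  open RealField R
  open Orth R

  +-commutativeMonoid : CommutativeMonoid 0ℓ 0ℓ
  +-commutativeMonoid = record
    { isCommutativeMonoid = AS.IsCommutativeRing.+-isCommutativeMonoid isCommutativeRing }

  open CommutativeMonoidSum +-commutativeMonoid using (sum; sum-permute; sum-cong-≗)

  sumᶠ≡sum : ∀ {m} (f : Fin m → ℝ) → sumᶠ f ≡ sum f
  sumᶠ≡sum {ℕ.zero} f = refl
  sumᶠ≡sum {suc m} f = cong (f Fin.zero +_) (sumᶠ≡sum (f ∘ Fin.suc))

  sumᶠ-reindex : ∀ {m} (π : Permutation′ m) (f g : Fin m → ℝ) →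
    (∀ j → f (π ⟨$⟩ʳ j) ≡ g j) → sumᶠ f ≡ sumᶠ g
  sumᶠ-reindex π f g f∘π≗g = begin
    sumᶠ f                   ≡⟨ sumᶠ≡sum f ⟩
    sum f                    ≡⟨ sum-permute f π ⟩
    sum (f ∘ (π ⟨$⟩ʳ_))      ≡⟨ sum-cong-≗ f∘π≗g ⟩
    sum g                    ≡⟨ sym (sumᶠ≡sum g) ⟩
    sumᶠ g                   ∎
    where open ≡-Reasoning

  module _ {n D : ℕ} (G : Graph n) (v : Rep n D) where
    open Graph G using (Adj)

    record Relabelling (σ τ : Permutation′ n) : Set where
      field
        ρ        : Permutation′ n
        σ∘ρ≗τ    : ∀ j → σ ⟨$⟩ʳ (ρ ⟨$⟩ʳ j) ≡ τ ⟨$⟩ʳ j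
        earlier⇔ : ∀ k j → Earlier G τ v k j ⇔ Earlier G σ v (ρ ⟨$⟩ʳ k) (ρ ⟨$⟩ʳ j)

    Relabelling-inverse : ∀ {σ τ} → Relabelling σ τ → Relabelling τ σ
    Relabelling-inverse {σ} {τ} r = record
      { ρ        = flip ρ
      ; σ∘ρ≗τ    = λ j → trans (sym (σ∘ρ≗τ (ρ ⟨$⟩ˡ j))) (cong (σ ⟨$⟩ʳ_) (inverseʳ ρ))
      ; earlier⇔ = λ k j →
          subst₂ (λ a b → Earlier G σ v a b ⇔ Earlier G τ v (ρ ⟨$⟩ˡ k) (ρ ⟨$⟩ˡ j))
                 (inverseʳ ρ) (inverseʳ ρ) (⇔.sym (earlier⇔ (ρ ⟨$⟩ˡ k) (ρ ⟨$⟩ˡ j)))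
      }
      where open Relabelling r

    module _ {σ τ : Permutation′ n} (r : Relabelling σ τ) where
      open Relabelling r

      PrevIndep-relabel : ∀ k → PrevIndep G σ v (ρ ⟨$⟩ʳ k) → PrevIndep G τ v k
      PrevIndep-relabel k indep c c-supported c-vanishes j =
        trans (cong c (sym (inverseˡ ρ))) (indep c′ c′-supported c′-vanishes (ρ ⟨$⟩ʳ j))
        where
        c′ : Fin n → ℝ
        c′ = c ∘ (ρ ⟨$⟩ˡ_)

        c′-supported : ∀ x → ¬ Earlier G σ v (ρ ⟨$⟩ʳ k) x → c′ x ≡ 0ᵣ
        c′-supported x not-earlier = c-supported (ρ ⟨$⟩ˡ x) λ earlier →
          not-earlier (subst (Earlier G σ v (ρ ⟨$⟩ʳ k)) (inverseʳ ρ)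
                             (Equivalence.to (earlier⇔ k (ρ ⟨$⟩ˡ x)) earlier))

        c′-vanishes : ∀ d → sumᶠ (λ x → c′ x * v (σ ⟨$⟩ʳ x) d) ≡ 0ᵣ
        c′-vanishes d = trans
          (sumᶠ-reindex ρ _ _ λ j →
            cong₂ (λ a b → c a * v b d) (inverseˡ ρ) (σ∘ρ≗τ j))
          (c-vanishes d)

    module _ {σ τ : Permutation′ n} (r : Relabelling σ τ) where
      open Relabelling r

      StepOK-relabel : ∀ k → StepOK G σ v (ρ ⟨$⟩ʳ k) → StepOK G τ v k
      StepOK-relabel k (inj₁ (indep , orthogonal)) = inj₁
        ( PrevIndep-relabel r k indep
        , λ j earlier → subst₂ (λ a b → v a · v b ≡ 0ᵣ) (σ∘ρ≗τ k) (σ∘ρ≗τ j)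
                               (orthogonal (ρ ⟨$⟩ʳ j) (Equivalence.to (earlier⇔ k j) earlier)))
      StepOK-relabel k (inj₂ (dep , v≡0)) = inj₂
        ( (λ indep → dep (PrevIndep-relabel (Relabelling-inverse r) (ρ ⟨$⟩ʳ k)
                            (subst (PrevIndep G τ v) (sym (inverseˡ ρ)) indep)))
        , λ d → subst (λ a → v a d ≡ 0ᵣ) (σ∘ρ≗τ k) (v≡0 d))

      GOR⁺-relabel : GOR⁺ G σ v → GOR⁺ G τ v
      GOR⁺-relabel gor k = StepOK-relabel k (gor (ρ ⟨$⟩ʳ k))

    adjacentTransposition-relabelling : ∀ {i i' : Fin n} → suc (toℕ i) ≡ toℕ i' →
      ∀ {σ τ} → (∀ j → σ ⟨$⟩ʳ PC.transpose i i' j ≡ τ ⟨$⟩ʳ j) →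
      Adj (τ ⟨$⟩ʳ i) (τ ⟨$⟩ʳ i') → Relabelling σ τ
    adjacentTransposition-relabelling {i} {i'} 1+i≡i' {σ} {τ} σ∘ρ≗τ edge = record
      { ρ        = Perm.transpose i i'
      ; σ∘ρ≗τ    = σ∘ρ≗τ
      ; earlier⇔ = λ k j → mk⇔
          (λ (j<k , ¬adj) →
              transpose-< j<k (λ { (refl , refl) → ¬adj edge })
            , ¬adj ∘ subst₂ Adj (σ∘ρ≗τ j) (σ∘ρ≗τ k))
          (λ (ρj<ρk , ¬adj) →
            let ¬adjτ = ¬adj ∘ subst₂ Adj (sym (σ∘ρ≗τ j)) (sym (σ∘ρ≗τ k)) in
              transpose-<⁻¹ ρj<ρk (λ { (refl , refl) → ¬adjτ (Graph.sym G edge) })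
            , ¬adjτ)
      }
      where open AdjacentTransposition 1+i≡i'

lemma7 : (R : RealField) → let open Orth R in
    (n : ℕ) (G : Graph n) (D : ℕ) → 1 ≤ D → D ≤ n →
    (i i' : Fin n) → suc (toℕ i) ≡ toℕ i' →
    (σ τ : Permutation′ n) →
    (∀ j → ¬ j ≡ i → ¬ j ≡ i' → σ ⟨$⟩ʳ j ≡ τ ⟨$⟩ʳ j) →
    σ ⟨$⟩ʳ i' ≡ τ ⟨$⟩ʳ i → σ ⟨$⟩ʳ i ≡ τ ⟨$⟩ʳ i' →
    Graph.Adj G (σ ⟨$⟩ʳ i) (σ ⟨$⟩ʳ i') →
    (v : Rep n D) → GOR⁺ G σ v ⇔ GOR⁺ G τ v
lemma7 R n G D _ _ i i' 1+i≡i' σ τ σ≗τ σi'≡τi σi≡τi' adj v =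
  mk⇔ (GOR⁺-relabel R G v r) (GOR⁺-relabel R G v (Relabelling-inverse R G v r))
  where
  open Orth R using (module Graph)

  r : Relabelling R G v σ τ
  r = adjacentTransposition-relabelling R G v 1+i≡i'
        (∘transpose≗ (σ ⟨$⟩ʳ_) (τ ⟨$⟩ʳ_) σ≗τ σi'≡τi σi≡τi')
        (Graph.sym G (subst₂ (Graph.Adj G) σi≡τi' σi'≡τi adj))
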